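{- Let $p$ be prime, $n\geq 2$ and $k\geq 1$. Then $$\operatorname{rank}(W_{p^k,n})\leq 1+\sum_{j=1}^k\operatorname{rank}(W^*_{p^j,n}),$$ and consequently $\operatorname{rank}(W_{p^k,n})\leq 1+k\cdot\operatorname{rank}(W^*_{p^k,n})$ (ranks over $\mathbb{Z}/p\mathbb{Z}$).
   Context: For $j\geq1$ let $R_j=\mathbb{Z}/p^j\mathbb{Z}$ and $\langle x,y\rangle=\sum_i x_iy_i\in R_j$ for $x,y\in R_j^n$. Directions $\mathbb{P}R_j^{n-1}$: vectors in $R_j^n$ with at least one invertible coordinate, modulo multiplication by units. $H_b=\{x\in R_j^n:\langle x,b\rangle=0\text{ in }R_j\}$. $W_{p^j,n}$ has rows and columns indexed by $R_j^n$, $(x,y)$ entry $1$ iff $\langle x,y\rangle=0$ in $R_j$, else $0$. $W^*_{p^j,n}$ has rows indexed by $b\in\mathbb{P}R_j^{n-1}$, columns indexed by $x\in R_j^n$, entry $1$ iff $x\in H_b$, else $0$. -}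

module Defs where

open import Data.Nat using (ℕ; zero; suc; _+_; _*_; _^_; _<_; _≤_)
open import Data.Nat.Divisibility using (_∣_; _∣?_)
open import Data.Fin using (Fin; toℕ)
open import Data.Product using (Σ; ∃; _×_; _,_)
open import Relation.Nullary.Decidable using (does)
open import Relation.Binary.PropositionalEquality using (_≡_)
open import Data.Bool using (if_then_else_)

sumFin : (m : ℕ) → (Fin m → ℕ) → ℕ
sumFin zero    f = 0
sumFin (suc m) f = f Fin.zero + sumFin m (λ i → f (Fin.suc i))

sum1to : ℕ → (ℕ → ℕ) → ℕ
sum1to k f = sumFin k (λ i → f (suc (toℕ i)))

-- Elements of R_j = ℤ/p^jℤ are represented by Fin (p ^ j) (residues 0 … p^j-1).
-- R_j^n
Vecs : (p j n : ℕ) → Set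
Vecs p j n = Fin n → Fin (p ^ j)

-- integer representative of ⟨x,y⟩; it is 0 in R_j iff p^j divides it
dotℕ : (p j n : ℕ) → Vecs p j n → Vecs p j n → ℕ
dotℕ p j n x y = sumFin n (λ i → toℕ (x i) * toℕ (y i))

Orth : (p j n : ℕ) → Vecs p j n → Vecs p j n → Set
Orth p j n x y = p ^ j ∣ dotℕ p j n x y

-- A matrix with rows indexed by R, columns by C, entries in ℕ (read mod p).
Mat : Set → Set → Set
Mat R C = R → C → ℕ

W : (p j n : ℕ) → Mat (Vecs p j n) (Vecs p j n)
W p j n x y = if does (p ^ j ∣? dotℕ p j n x y) then 1 else 0

-- Directions ℙR_j^{n-1}: each class of vectors with an invertible coordinate modulo
-- units has exactly one representative whose first invertible coordinate equals 1
-- (and all earlier coordinates are non-units, i.e. divisible by p).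
-- We index directions by these canonical representatives.
IsNormalized : (p j n : ℕ) → Vecs p j n → Set
IsNormalized p j n b =
  ∃ λ (i : Fin n) → (toℕ (b i) ≡ 1) × (∀ (i' : Fin n) → toℕ i' < toℕ i → p ∣ toℕ (b i'))

Direction : (p j n : ℕ) → Set
Direction p j n = Σ (Vecs p j n) (IsNormalized p j n)

W* : (p j n : ℕ) → Mat (Direction p j n) (Vecs p j n)
W* p j n (b , _) x = if does (p ^ j ∣? dotℕ p j n x b) then 1 else 0

RowsIndependent : ∀ {R C : Set} → ℕ → Mat R C → (r : ℕ) → (Fin r → R) → Set
RowsIndependent {C = C} p M r f =
  (c : Fin r → ℕ) →
  (∀ (col : C) → p ∣ sumFin r (λ i → c i * M (f i) col)) →
  ∀ (i : Fin r) → p ∣ c i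

IsRank : ∀ {R C : Set} → ℕ → Mat R C → ℕ → Set
IsRank {R} p M r =
  (Σ (Fin r → R) (RowsIndependent p M r)) ×
  (∀ (s : ℕ) (g : Fin s → R) → RowsIndependent p M s g → s ≤ r)

module Submission where

-- Write a nonzero x ∈ R_k^n as p^m·y with y primitive, and let j = k − m ≥ 1.  Multiplying y by
-- an inverse, modulo p^j, of its first coordinate prime to p gives a normalised direction b with
-- ⟨x,z⟩ = 0 in R_k iff ⟨z mod p^j, b⟩ = 0 in R_j: the row of W_{p^k,n} at x is the row of
-- W*_{p^j,n} at b, read through reduction modulo p^j.  An independent family of rows of
-- W_{p^k,n} therefore contains at most rank W*_{p^j,n} rows of each level j ≥ 1, and at most one
-- row of level 0 (x = 0, an all-ones row); summing over the levels gives the first bound.  For the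
-- second, multiplication by p^(k−j) embeds R_j^n into R_k^n so that the row of W*_{p^j,n} at b is
-- a restriction of the row of W*_{p^k,n} at b, whence rank W*_{p^j,n} ≤ rank W*_{p^k,n}.

open import Defs
import Data.Nat.Properties as ℕ
open import Algebra.Properties.Semiring.Sum ℕ.+-*-semiring
  using (sum-syntax; sum-cong-≗; ∑-comm; *-distribˡ-sum; *-distribʳ-sum; sum-init-last; sum-replicate-zero)
open import Data.Nat
  using (ℕ; zero; suc; _+_; _*_; _∸_; _^_; _≤_; _<_; _≟_; z≤n; s≤s; z<s; s<s; NonZero; nonTrivial⇒n>1)
open import Data.Nat.Properties
open import Data.Nat.Divisibility
open import Data.Nat.DivMod
open import Data.Nat.Primality using (Prime; prime⇒irreducible; prime⇒nonZero; prime⇒nonTrivial)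
open import Data.Nat.Coprimality as Coprime using (Coprime; 1-coprimeTo; coprime-divisor; coprime-Bézout)
open import Data.Nat.GCD using (module Bézout)
open import Data.Nat.Tactic.RingSolver using (solve-∀)
open import Data.Fin as Fin using (Fin; toℕ; inject₁; inject≤; fromℕ; fromℕ<) renaming (_≟_ to _≟ᶠ_)
open import Data.Fin.Properties
  using (toℕ-inject₁; toℕ-inject≤; toℕ-inject; toℕ-fromℕ; toℕ-fromℕ<; toℕ-injective; toℕ<n; all?; ¬∀⟶∃¬-smallest)
open import Data.List using (List; []; _∷_; length; lookup; filter; allFin)
open import Data.List.Properties using (length-tabulate)
open import Data.List.Relation.Unary.All as All using (All)
import Data.List.Relation.Unary.All.Properties as Allₚ
open import Data.List.Relation.Unary.AllPairs using (_∷_)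
open import Data.List.Relation.Unary.Unique.Propositional using (Unique)
import Data.List.Relation.Unary.Unique.Propositional.Properties as Uniqueₚ
open import Data.List.Membership.Propositional.Properties using (∈-lookup)
open import Data.Bool using (if_then_else_)
open import Data.Product using (Σ; ∃; _×_; _,_; proj₁; proj₂)
open import Data.Sum using (_⊎_; inj₁; inj₂)
open import Function using (_∘_; Injective)
open import Function.Bundles using (_⇔_; mk⇔; module Equivalence)
import Function.Properties.Equivalence as ⇔
open import Level using (0ℓ)
open import Relation.Nullary using (¬_; Dec; yes; no; does; contradiction)
open import Relation.Nullary.Decidable using (does-⇔; dec-true)
open import Relation.Unary using (Pred; Decidable)
open import Relation.Unary.Properties using (∁?)
open import Relation.Binary.PropositionalEquality

-- Finite sums

sumFin≡∑ : ∀ m (f : Fin m → ℕ) → sumFin m f ≡ ∑[ i < m ] f i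
sumFin≡∑ zero    f = refl
sumFin≡∑ (suc m) f = cong (f Fin.zero +_) (sumFin≡∑ m (f ∘ Fin.suc))

sumFin-cong : ∀ m {f g : Fin m → ℕ} → (∀ i → f i ≡ g i) → sumFin m f ≡ sumFin m g
sumFin-cong zero    f≡g = refl
sumFin-cong (suc m) f≡g = cong₂ _+_ (f≡g Fin.zero) (sumFin-cong m (f≡g ∘ Fin.suc))

sumFin-*ˡ : ∀ m c (f : Fin m → ℕ) → sumFin m (λ i → c * f i) ≡ c * sumFin m f
sumFin-*ˡ m c f = begin
  sumFin m (λ i → c * f i)  ≡⟨ sumFin≡∑ m (λ i → c * f i) ⟩
  ∑[ i < m ] (c * f i)      ≡⟨ *-distribˡ-sum c f ⟨
  c * ∑[ i < m ] f i        ≡⟨ cong (c *_) (sumFin≡∑ m f) ⟨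
  c * sumFin m f            ∎
  where open ≡-Reasoning

sumFin-scaled : ∀ m {a y : Fin m → ℕ} c (z : Fin m → ℕ) → (∀ i → a i ≡ c * y i) →
  sumFin m (λ i → a i * z i) ≡ c * sumFin m (λ i → y i * z i)
sumFin-scaled m {a} {y} c z a≡cy = begin
  sumFin m (λ i → a i * z i)
    ≡⟨ sumFin-cong m (λ i → trans (cong (_* z i) (a≡cy i)) (*-assoc c (y i) (z i))) ⟩
  sumFin m (λ i → c * (y i * z i))  ≡⟨ sumFin-*ˡ m c (λ i → y i * z i) ⟩
  c * sumFin m (λ i → y i * z i)    ∎
  where open ≡-Reasoning

sumFin-snoc : ∀ m (f : ℕ → ℕ) → sumFin (suc m) (λ i → f (toℕ i)) ≡ sumFin m (λ i → f (toℕ i)) + f m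
sumFin-snoc m f = begin
  sumFin (suc m) (λ i → f (toℕ i))                    ≡⟨ sumFin≡∑ (suc m) (λ i → f (toℕ i)) ⟩
  ∑[ i < suc m ] f (toℕ i)                            ≡⟨ sum-init-last {m} (λ i → f (toℕ i)) ⟩
  ∑[ i < m ] f (toℕ (inject₁ i)) + f (toℕ (fromℕ m))
    ≡⟨ cong₂ _+_ (sum-cong-≗ {m} (λ i → cong f (toℕ-inject₁ i))) (cong f (toℕ-fromℕ m)) ⟩
  ∑[ i < m ] f (toℕ i) + f m                          ≡⟨ cong (_+ f m) (sumFin≡∑ m (λ i → f (toℕ i))) ⟨
  sumFin m (λ i → f (toℕ i)) + f m                    ∎
  where open ≡-Reasoning

sumFin-≤ : ∀ m (f : Fin m → ℕ) {b} → (∀ i → f i ≤ b) → sumFin m f ≤ m * b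
sumFin-≤ zero    f f≤b = z≤n
sumFin-≤ (suc m) f f≤b = +-mono-≤ (f≤b Fin.zero) (sumFin-≤ m (f ∘ Fin.suc) (f≤b ∘ Fin.suc))

sumFin-cong-% : ∀ m N .{{_ : NonZero N}} {f g : Fin m → ℕ} →
  (∀ i → f i % N ≡ g i % N) → sumFin m f % N ≡ sumFin m g % N
sumFin-cong-% zero    N f≡g = refl
sumFin-cong-% (suc m) N {f} {g} f≡g = begin
  (f Fin.zero + sumFin m (f ∘ Fin.suc)) % N              ≡⟨ %-distribˡ-+ (f Fin.zero) _ N ⟩
  (f Fin.zero % N + sumFin m (f ∘ Fin.suc) % N) % N
    ≡⟨ cong₂ (λ a b → (a + b) % N) (f≡g Fin.zero) (sumFin-cong-% m N (f≡g ∘ Fin.suc)) ⟩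
  (g Fin.zero % N + sumFin m (g ∘ Fin.suc) % N) % N      ≡⟨ %-distribˡ-+ (g Fin.zero) _ N ⟨
  (g Fin.zero + sumFin m (g ∘ Fin.suc)) % N              ∎
  where open ≡-Reasoning

δ : ∀ {m} → Fin m → Fin m → ℕ
δ a i = if does (a ≟ᶠ i) then 1 else 0

∑-δ : ∀ {m} (a : Fin m) (G : Fin m → ℕ) → ∑[ i < m ] (δ a i * G i) ≡ G a
∑-δ {suc m} Fin.zero    G =
  trans (cong₂ _+_ (*-identityˡ (G Fin.zero)) (sum-replicate-zero m)) (+-identityʳ (G Fin.zero))
∑-δ {suc m} (Fin.suc a) G = ∑-δ a (G ∘ Fin.suc)

δ-injective : ∀ {q s} {h : Fin q → Fin s} → Injective _≡_ _≡_ h → ∀ i j → δ (h i) (h j) ≡ δ j i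
δ-injective {h = h} h-inj i j with h i ≟ᶠ h j | j ≟ᶠ i
... | yes _     | yes _   = refl
... | no  _     | no  _   = refl
... | yes hi≡hj | no j≢i  = contradiction (sym (h-inj hi≡hj)) j≢i
... | no  hi≢hj | yes j≡i = contradiction (cong h (sym j≡i)) hi≢hj

Unique⇒lookup-injective : ∀ {A : Set} {xs : List A} → Unique xs → Injective _≡_ _≡_ (lookup xs)
Unique⇒lookup-injective (_ ∷ _)         {Fin.zero}  {Fin.zero}  _  = refl
Unique⇒lookup-injective (x∉xs ∷ _)      {Fin.zero}  {Fin.suc j} eq =
  contradiction eq (All.lookup x∉xs (∈-lookup j))
Unique⇒lookup-injective (x∉xs ∷ _)      {Fin.suc i} {Fin.zero}  eq =
  contradiction (sym eq) (All.lookup x∉xs (∈-lookup i))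
Unique⇒lookup-injective (_ ∷ xs-unique) {Fin.suc i} {Fin.suc j} eq =
  cong Fin.suc (Unique⇒lookup-injective xs-unique eq)

length-filter+length-filter-∁ : ∀ {A : Set} {P : Pred A 0ℓ} (P? : Decidable P) xs →
  length (filter P? xs) + length (filter (∁? P?) xs) ≡ length xs
length-filter+length-filter-∁ P? []       = refl
length-filter+length-filter-∁ P? (x ∷ xs) with P? x
... | yes _ = cong suc (length-filter+length-filter-∁ P? xs)
... | no  _ = trans (+-suc _ _) (cong suc (length-filter+length-filter-∁ P? xs))

least-counterexample : ∀ {n} {P : Pred (Fin n) 0ℓ} → Decidable P → ¬ (∀ i → P i) →
  ∃ λ i → ¬ P i × (∀ j → toℕ j < toℕ i → P j)
least-counterexample {n} {P} P? ¬∀P with ¬∀⟶∃¬-smallest n P P? ¬∀P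
... | i , ¬Pi , P-before = i , ¬Pi , λ j j<i → subst P (inject-fromℕ< j j<i) (P-before (fromℕ< j<i))
  where
  inject-fromℕ< : ∀ j (j<i : toℕ j < toℕ i) → Fin.inject (fromℕ< j<i) ≡ j
  inject-fromℕ< j j<i = toℕ-injective (trans (toℕ-inject (fromℕ< j<i)) (toℕ-fromℕ< j<i))

-- Independent rows over ℤ/pℤ

module _ {R C : Set} (p : ℕ) (M : Mat R C) where

  independent-∘-injective : ∀ {s q} {g : Fin s → R} {h : Fin q → Fin s} →
    Injective _≡_ _≡_ h → RowsIndependent p M s g → RowsIndependent p M q (g ∘ h)
  independent-∘-injective {s} {q} {g} {h} h-inj g-indep c′ c′-dep i =
    subst (p ∣_) (c∘h≡c′ i) (g-indep c c-dep (h i))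
    where
    c : Fin s → ℕ
    c i = ∑[ j < q ] (δ (h j) i * c′ j)

    c∘h≡c′ : ∀ i → c (h i) ≡ c′ i
    c∘h≡c′ i = trans (sum-cong-≗ (λ j → cong (_* c′ j) (δ-injective h-inj j i))) (∑-δ i c′)

    same-combination : ∀ col →
      sumFin s (λ i → c i * M (g i) col) ≡ sumFin q (λ j → c′ j * M (g (h j)) col)
    same-combination col = begin
      sumFin s (λ i → c i * M (g i) col)                        ≡⟨ sumFin≡∑ s (λ i → c i * M (g i) col) ⟩
      ∑[ i < s ] (c i * M (g i) col)
        ≡⟨ sum-cong-≗ (λ i → *-distribʳ-sum (M (g i) col) (λ j → δ (h j) i * c′ j)) ⟩
      ∑[ i < s ] ∑[ j < q ] (δ (h j) i * c′ j * M (g i) col)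
        ≡⟨ ∑-comm (λ i j → δ (h j) i * c′ j * M (g i) col) ⟩
      ∑[ j < q ] ∑[ i < s ] (δ (h j) i * c′ j * M (g i) col)
        ≡⟨ sum-cong-≗ (λ j → sum-cong-≗ (λ i → *-assoc (δ (h j) i) (c′ j) (M (g i) col))) ⟩
      ∑[ j < q ] ∑[ i < s ] (δ (h j) i * (c′ j * M (g i) col))
        ≡⟨ sum-cong-≗ (λ j → ∑-δ (h j) (λ i → c′ j * M (g i) col)) ⟩
      ∑[ j < q ] (c′ j * M (g (h j)) col)                       ≡⟨ sumFin≡∑ q (λ j → c′ j * M (g (h j)) col) ⟨
      sumFin q (λ j → c′ j * M (g (h j)) col)                   ∎
      where open ≡-Reasoning

    c-dep : ∀ col → p ∣ sumFin s (λ i → c i * M (g i) col)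
    c-dep col = subst (p ∣_) (sym (same-combination col)) (c′-dep col)

  independent-of-restriction : ∀ {R′ C′ : Set} {M′ : Mat R′ C′} {s} {g : Fin s → R} {f : Fin s → R′}
    (φ : C → C′) → (∀ i col → M (g i) col ≡ M′ (f i) (φ col)) →
    RowsIndependent p M s g → RowsIndependent p M′ s f
  independent-of-restriction {s = s} φ g≡f∘φ g-indep c c-dep = g-indep c λ col →
    subst (p ∣_) (sumFin-cong s (λ i → cong (c i *_) (sym (g≡f∘φ i col)))) (c-dep (φ col))

  independent-equal-rows : 1 < p → ∀ {s} {g : Fin s → R} → RowsIndependent p M s g →
    (∀ i j col → M (g i) col ≡ M (g j) col) → s ≤ 1
  independent-equal-rows _   {zero}            _       _     = z≤n
  independent-equal-rows _   {suc zero}        _       _     = ≤-refl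
  independent-equal-rows 1<p {suc (suc s)} {g} g-indep equal =
    contradiction (∣1⇒≡1 (g-indep c c-dep Fin.zero)) (>⇒≢ 1<p)
    where
    c : Fin (suc (suc s)) → ℕ
    c Fin.zero              = 1
    c (Fin.suc Fin.zero)    = p ∸ 1
    c (Fin.suc (Fin.suc _)) = 0

    c-dep : ∀ col → p ∣ sumFin (suc (suc s)) (λ i → c i * M (g i) col)
    c-dep col = divides a (begin
      1 * a + ((p ∸ 1) * a′ + sumFin s (λ i → 0 * rest i))
        ≡⟨ cong₂ (λ x y → 1 * a + ((p ∸ 1) * x + y)) (equal _ _ col) (sumFin-*ˡ s 0 rest) ⟩
      1 * a + ((p ∸ 1) * a + 0)  ≡⟨ cong (1 * a +_) (+-identityʳ _) ⟩
      1 * a + (p ∸ 1) * a        ≡⟨ *-distribʳ-+ a 1 (p ∸ 1) ⟨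
      (1 + (p ∸ 1)) * a          ≡⟨ cong (_* a) (m+[n∸m]≡n (<⇒≤ 1<p)) ⟩
      p * a                      ≡⟨ *-comm p a ⟩
      a * p                      ∎)
      where
      open ≡-Reasoning
      a  = M (g Fin.zero) col
      a′ = M (g (Fin.suc Fin.zero)) col
      rest : Fin s → ℕ
      rest i = M (g (Fin.suc (Fin.suc i))) col

  ClassBound : (R → ℕ) → ℕ → ℕ → Set
  ClassBound level t b =
    ∀ {q} (h : Fin q → R) → (∀ i → level (h i) ≡ t) → RowsIndependent p M q h → q ≤ b

  independent-≤-∑ClassBound : (level : R → ℕ) (B : ℕ → ℕ) (K : ℕ) →
    (∀ t → t ≤ K → ClassBound level t (B t)) →
    ∀ {s} {g : Fin s → R} → RowsIndependent p M s g → (∀ i → level (g i) ≤ K) →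
    s ≤ sumFin (suc K) (λ t → B (toℕ t))
  independent-≤-∑ClassBound level B K bound {s} {g} g-indep g≤K =
    subst (_≤ _) (length-tabulate (λ i → i))
      (count K ≤-refl (allFin s) (Uniqueₚ.allFin⁺ s) (Allₚ.tabulate⁺ g≤K))
    where
    within-class : ∀ t → t ≤ K → (L : List (Fin s)) → Unique L →
      All (λ i → level (g i) ≡ t) L → length L ≤ B t
    within-class t t≤K L L-unique L≡t =
      bound t t≤K (g ∘ lookup L) (λ i → All.lookup L≡t (∈-lookup i))
        (independent-∘-injective (Unique⇒lookup-injective L-unique) g-indep)

    count : ∀ t → t ≤ K → (L : List (Fin s)) → Unique L →
      All (λ i → level (g i) ≤ t) L → length L ≤ sumFin (suc t) (λ u → B (toℕ u))
    count zero    t≤K L L-unique L≤0 = subst (length L ≤_) (sym (+-identityʳ (B 0)))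
      (within-class 0 t≤K L L-unique (All.map n≤0⇒n≡0 L≤0))
    count (suc t) t≤K L L-unique L≤t+1 = begin
      length L                                              ≡⟨ length-filter+length-filter-∁ top? L ⟨
      length (filter top? L) + length (filter (∁? top?) L)
        ≤⟨ +-mono-≤ (within-class (suc t) t≤K _ (Uniqueₚ.filter⁺ top? L-unique) (Allₚ.all-filter top? L))
                    (count t (≤-trans (n≤1+n t) t≤K) _ (Uniqueₚ.filter⁺ (∁? top?) L-unique) below) ⟩
      B (suc t) + sumFin (suc t) (λ u → B (toℕ u))          ≡⟨ +-comm (B (suc t)) _ ⟩
      sumFin (suc t) (λ u → B (toℕ u)) + B (suc t)          ≡⟨ sumFin-snoc (suc t) B ⟨
      sumFin (suc (suc t)) (λ u → B (toℕ u))                ∎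
      where
      open ≤-Reasoning
      top? : Decidable (λ i → level (g i) ≡ suc t)
      top? i = level (g i) ≟ suc t
      below : All (λ i → level (g i) ≤ t) (filter (∁? top?) L)
      below = All.zipWith (λ (≤t+1 , ≢t+1) → ≤-pred (≤∧≢⇒< ≤t+1 ≢t+1))
                (Allₚ.filter⁺ (∁? top?) L≤t+1 , Allₚ.all-filter (∁? top?) L)

-- Arithmetic modulo prime powers

%-≡⇒∣⇔ : ∀ {a b N} .{{_ : NonZero N}} → a % N ≡ b % N → N ∣ a ⇔ N ∣ b
%-≡⇒∣⇔ {a} {b} {N} a≡b = mk⇔
  (λ N∣a → m%n≡0⇒n∣m b N (trans (sym a≡b) (n∣m⇒m%n≡0 a N N∣a)))
  (λ N∣b → m%n≡0⇒n∣m a N (trans a≡b (n∣m⇒m%n≡0 b N N∣b)))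

*-cancelˡ-∣⇔ : ∀ c {a b} .{{_ : NonZero c}} → c * a ∣ c * b ⇔ a ∣ b
*-cancelˡ-∣⇔ c = mk⇔ (*-cancelˡ-∣ c) (*-monoʳ-∣ c)

¬∣⇒coprime-^ : ∀ {p a} → Prime p → ¬ p ∣ a → ∀ j → Coprime a (p ^ j)
¬∣⇒coprime-^ {a = a} p-prime p∤a zero = Coprime.sym (1-coprimeTo a)
¬∣⇒coprime-^ {p} {a} p-prime p∤a (suc j) {d} (d∣a , d∣p*p^j) =
  ¬∣⇒coprime-^ p-prime p∤a j (d∣a , coprime-divisor d⊥p d∣p*p^j)
  where
  d⊥p : Coprime d p
  d⊥p (e∣d , e∣p) with prime⇒irreducible p-prime e∣p
  ... | inj₁ e≡1 = e≡1
  ... | inj₂ refl = contradiction (∣-trans e∣d d∣a) p∤a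

coprime⇒inverse-mod : ∀ {a N} .{{_ : NonZero N}} → 1 < N → Coprime a N → ∃ λ u → (u * a) % N ≡ 1
coprime⇒inverse-mod {a} {N} 1<N a⊥N with coprime-Bézout a⊥N
... | Bézout.+- x y 1+yN≡xa = x , (begin
  (x * a) % N      ≡⟨ cong (_% N) 1+yN≡xa ⟨
  (1 + y * N) % N  ≡⟨ [m+kn]%n≡m%n 1 y N ⟩
  1 % N            ≡⟨ m<n⇒m%n≡m 1<N ⟩
  1                ∎)
  where open ≡-Reasoning
-- Here x·a ≡ −1 (mod N), so (N − 1)·x inverts a.
coprime⇒inverse-mod {a} {suc N′} 1<N a⊥N | Bézout.-+ x y 1+xa≡yN = N′ * x , (begin
  (N′ * x * a) % N                ≡⟨ [m+kn]%n≡m%n (N′ * x * a) y N ⟨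
  (N′ * x * a + y * N) % N        ≡⟨ cong (λ t → (N′ * x * a + t) % N) 1+xa≡yN ⟨
  (N′ * x * a + (1 + x * a)) % N  ≡⟨ cong (_% N) (regroup N′ x a) ⟩
  (1 + x * a * N) % N             ≡⟨ [m+kn]%n≡m%n 1 (x * a) N ⟩
  1 % N                           ≡⟨ m<n⇒m%n≡m 1<N ⟩
  1                               ∎)
  where
  open ≡-Reasoning
  N = suc N′
  regroup : ∀ N′ x a → N′ * x * a + (1 + x * a) ≡ 1 + x * a * suc N′
  regroup = solve-∀

unit-∣⇔ : ∀ {u a N} .{{_ : NonZero N}} → (u * a) % N ≡ 1 → ∀ S → N ∣ u * S ⇔ N ∣ S
unit-∣⇔ {u} {a} {N} ua≡1 S = mk⇔
  (λ N∣uS → Equivalence.to (%-≡⇒∣⇔ uaS≡S) (subst (N ∣_) (regroup a u S) (∣n⇒∣m*n a N∣uS)))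
  (∣n⇒∣m*n u)
  where
  regroup : ∀ a u S → a * (u * S) ≡ u * a * S
  regroup = solve-∀
  uaS≡S : (u * a * S) % N ≡ S % N
  uaS≡S = begin
    (u * a * S) % N              ≡⟨ %-distribˡ-* (u * a) S N ⟩
    ((u * a) % N * (S % N)) % N  ≡⟨ cong (λ t → (t * (S % N)) % N) ua≡1 ⟩
    (1 * (S % N)) % N            ≡⟨ cong (_% N) (*-identityˡ (S % N)) ⟩
    S % N % N                    ≡⟨ m%n%n≡m%n S N ⟩
    S % N                        ∎
    where open ≡-Reasoning

record PrimitiveFactorisation (p t : ℕ) {n} (a : Fin n → ℕ) : Set where
  field
    exponent      : ℕ
    exponent<t    : exponent < t
    primitivePart : Fin n → ℕ
    factorises    : ∀ i → a i ≡ p ^ exponent * primitivePart i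
    pivot         : Fin n
    pivot-unit    : ¬ p ∣ primitivePart pivot
    before-pivot  : ∀ i → toℕ i < toℕ pivot → p ∣ primitivePart i

factorise : ∀ {p} .{{_ : NonZero p}} t {n} (a : Fin n → ℕ) → (∀ i → a i < p ^ t) →
  (∀ i → a i ≡ 0) ⊎ PrimitiveFactorisation p t a
factorise zero a a<1 = inj₁ (λ i → n<1⇒n≡0 (a<1 i))
factorise {p} (suc t) a a<p^t+1 with all? (λ i → p ∣? a i)
... | no ¬p∣a with least-counterexample (λ i → p ∣? a i) ¬p∣a
...   | i , p∤ai , p∣before = inj₂ record
  { exponent = 0 ; exponent<t = z<s ; primitivePart = a ; factorises = λ i → sym (*-identityˡ (a i))
  ; pivot = i ; pivot-unit = p∤ai ; before-pivot = p∣before }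
factorise {p} (suc t) {n} a a<p^t+1 | yes p∣a with factorise t q q<p^t
  where
  q : Fin n → ℕ
  q i = quotient (p∣a i)
  q<p^t : ∀ i → q i < p ^ t
  q<p^t i = *-cancelʳ-< p (q i) (p ^ t)
    (subst₂ _<_ (m∣n⇒n≡quotient*m (p∣a i)) (*-comm p (p ^ t)) (a<p^t+1 i))
... | inj₁ q≡0 = inj₁ (λ i → trans (m∣n⇒n≡quotient*m (p∣a i)) (cong (_* p) (q≡0 i)))
... | inj₂ F = inj₂ record
  { exponent = suc exponent ; exponent<t = s<s exponent<t ; primitivePart = primitivePart
  ; factorises = λ i → trans (m∣n⇒n≡quotient*m (p∣a i)) (begin
      quotient (p∣a i) * p                ≡⟨ cong (_* p) (factorises i) ⟩
      p ^ exponent * primitivePart i * p  ≡⟨ regroup (p ^ exponent) (primitivePart i) p ⟩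
      p * p ^ exponent * primitivePart i  ∎)
  ; pivot = pivot ; pivot-unit = pivot-unit ; before-pivot = before-pivot }
  where
  open PrimitiveFactorisation F
  open ≡-Reasoning
  regroup : ∀ a b c → a * b * c ≡ c * a * b
  regroup = solve-∀

-- Rows of W and W*

indicator-cong : ∀ {A B : Set} (a? : Dec A) (b? : Dec B) → A ⇔ B →
  (if does a? then 1 else 0) ≡ (if does b? then 1 else 0)
indicator-cong a? b? A⇔B = cong (λ b → if b then 1 else 0) (does-⇔ A⇔B a? b?)

module _ {p : ℕ} (p-prime : Prime p) {n : ℕ} where

  private instance
    p≢0 : NonZero p
    p≢0 = prime⇒nonZero p-prime

  1<p : 1 < p
  1<p = nonTrivial⇒n>1 p {{prime⇒nonTrivial p-prime}}

  p^k≡p^m*p^[k∸m] : ∀ {m k} → m ≤ k → p ^ k ≡ p ^ m * p ^ (k ∸ m)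
  p^k≡p^m*p^[k∸m] {m} {k} m≤k = trans (cong (p ^_) (sym (m+[n∸m]≡n m≤k))) (^-distribˡ-+-* p m (k ∸ m))

  p^[k∸m]*p^m≡p^k : ∀ {m k} → m ≤ k → p ^ (k ∸ m) * p ^ m ≡ p ^ k
  p^[k∸m]*p^m≡p^k {m} {k} m≤k = trans (*-comm (p ^ (k ∸ m)) (p ^ m)) (sym (p^k≡p^m*p^[k∸m] m≤k))

  reduce : ∀ {m} j → (Fin n → Fin m) → Vecs p j n
  reduce j z i = fromℕ< (m%n<n (toℕ (z i)) (p ^ j) {{m^n≢0 p j}})

  RowFactors : ∀ k j → Vecs p k n → Direction p j n → Set
  RowFactors k j x d = ∀ z → W p k n x z ≡ W* p j n d (reduce j z)

  pivot-direction : ∀ j → 1 ≤ j → (y : Fin n → ℕ) (i : Fin n) →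
    ¬ p ∣ y i → (∀ i′ → toℕ i′ < toℕ i → p ∣ y i′) →
    Σ (Direction p j n) λ d → ∀ {m} (z : Fin n → Fin m) →
      Orth p j n (reduce j z) (proj₁ d) ⇔ p ^ j ∣ sumFin n (λ i → y i * toℕ (z i))
  pivot-direction (suc j) _ y i p∤yi p∣before = (b , i , b-pivot , b-before) , orth⇔
    where
    N = p ^ suc j
    instance
      N≢0 : NonZero N
      N≢0 = m^n≢0 p (suc j)
    inverse : ∃ λ u → (u * y i) % N ≡ 1
    inverse = coprime⇒inverse-mod (^-monoʳ-< p 1<p {0} {suc j} z<s) (¬∣⇒coprime-^ p-prime p∤yi (suc j))
    u = proj₁ inverse
    uy≡1 : (u * y i) % N ≡ 1
    uy≡1 = proj₂ inverse

    b : Vecs p (suc j) n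
    b i′ = fromℕ< (m%n<n (u * y i′) N)
    b≡uy : ∀ i′ → toℕ (b i′) ≡ (u * y i′) % N
    b≡uy i′ = toℕ-fromℕ< (m%n<n (u * y i′) N)
    b-pivot : toℕ (b i) ≡ 1
    b-pivot = trans (b≡uy i) uy≡1
    b-before : ∀ i′ → toℕ i′ < toℕ i → p ∣ toℕ (b i′)
    b-before i′ i′<i =
      subst (p ∣_) (sym (b≡uy i′)) (%-presˡ-∣ (∣n⇒∣m*n u (p∣before i′ i′<i)) (m∣m*n (p ^ j)))

    orth⇔ : ∀ {m} (z : Fin n → Fin m) →
      Orth p (suc j) n (reduce (suc j) z) b ⇔ N ∣ sumFin n (λ i → y i * toℕ (z i))
    orth⇔ z = ⇔.trans (%-≡⇒∣⇔ {N = N} dot≡uS) (unit-∣⇔ {u} {y i} {N} uy≡1 S)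
      where
      S = sumFin n (λ i → y i * toℕ (z i))
      termwise : ∀ i′ → (toℕ (reduce (suc j) z i′) * toℕ (b i′)) % N ≡ (toℕ (z i′) * (u * y i′)) % N
      termwise i′ = begin
        (toℕ (reduce (suc j) z i′) * toℕ (b i′)) % N
          ≡⟨ cong₂ (λ s t → (s * t) % N) (toℕ-fromℕ< (m%n<n (toℕ (z i′)) N)) (b≡uy i′) ⟩
        ((toℕ (z i′) % N) * ((u * y i′) % N)) % N  ≡⟨ %-distribˡ-* (toℕ (z i′)) (u * y i′) N ⟨
        (toℕ (z i′) * (u * y i′)) % N              ∎
        where open ≡-Reasoning
      dot≡uS : dotℕ p (suc j) n (reduce (suc j) z) b % N ≡ (u * S) % N
      dot≡uS = trans (sumFin-cong-% n N termwise)
        (cong (_% N) (trans (sumFin-cong n (λ i′ → regroup (toℕ (z i′)) u (y i′))) (sumFin-*ˡ n u _)))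
        where
        regroup : ∀ z u y → z * (u * y) ≡ u * (y * z)
        regroup = solve-∀

  row-factors : ∀ {k} (x : Vecs p k n) (F : PrimitiveFactorisation p k (λ i → toℕ (x i))) →
    let j = k ∸ PrimitiveFactorisation.exponent F in Σ (Direction p j n) (RowFactors k j x)
  row-factors {k} x F =
    d , λ z → indicator-cong (_ ∣? _) (_ ∣? _) (⇔.trans (orth-k z) (⇔.sym (d-orth z)))
    where
    open PrimitiveFactorisation F
    j = k ∸ exponent
    pivoted = pivot-direction j (m<n⇒0<n∸m exponent<t) primitivePart pivot pivot-unit before-pivot
    d = proj₁ pivoted
    d-orth = proj₂ pivoted
    orth-k : ∀ z → Orth p k n x z ⇔ p ^ j ∣ sumFin n (λ i → primitivePart i * toℕ (z i))
    orth-k z = subst₂ (λ a b → (a ∣ b) ⇔ (p ^ j ∣ S))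
      (sym (p^k≡p^m*p^[k∸m] (<⇒≤ exponent<t)))
      (sym (sumFin-scaled n (p ^ exponent) (λ i → toℕ (z i)) factorises))
      (*-cancelˡ-∣⇔ (p ^ exponent) {{m^n≢0 p exponent}})
      where S = sumFin n (λ i → primitivePart i * toℕ (z i))

  RowClass : ∀ k → Vecs p k n → Set
  RowClass k x = (∀ i → toℕ (x i) ≡ 0) ⊎ ∃ λ j → 1 ≤ j × j ≤ k × Σ (Direction p j n) (RowFactors k j x)

  classify : ∀ k (x : Vecs p k n) → RowClass k x
  classify k x with factorise k (λ i → toℕ (x i)) (λ i → toℕ<n (x i))
  ... | inj₁ x≡0 = inj₁ x≡0
  ... | inj₂ F   = inj₂ (k ∸ exponent , m<n⇒0<n∸m exponent<t , m∸n≤m k exponent , row-factors x F)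
    where open PrimitiveFactorisation F

  level : ∀ k → Vecs p k n → ℕ
  level k x with classify k x
  ... | inj₁ _       = 0
  ... | inj₂ (j , _) = j

  level≤ : ∀ k x → level k x ≤ k
  level≤ k x with classify k x
  ... | inj₁ _                 = z≤n
  ... | inj₂ (_ , _ , j≤k , _) = j≤k

  level-zero-row : ∀ k x → level k x ≡ 0 → ∀ z → W p k n x z ≡ 1
  level-zero-row k x level≡0 z with classify k x
  ... | inj₂ (zero , () , _)
  ... | inj₂ (suc _ , _) = contradiction level≡0 λ ()
  ... | inj₁ x≡0 = cong (λ b → if b then 1 else 0) (dec-true (p ^ k ∣? dotℕ p k n x z)
    (subst (p ^ k ∣_) (sym (sumFin-scaled n {y = λ _ → 0} 0 (λ i → toℕ (z i)) x≡0)) ((p ^ k) ∣0)))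

  level-row-factors : ∀ k x {t} → level k x ≡ suc t → Σ (Direction p (suc t) n) (RowFactors k (suc t) x)
  level-row-factors k x level≡t+1 with classify k x
  ... | inj₁ _                     = contradiction level≡t+1 λ ()
  ... | inj₂ (j , _ , _ , factors) = subst (λ j → Σ (Direction p j n) (RowFactors k j x)) level≡t+1 factors

  level-zero-bound : ∀ k → ClassBound p (W p k n) (level k) 0 1
  level-zero-bound k h h≡0 h-indep = independent-equal-rows p (W p k n) 1<p {g = h} h-indep
    (λ i j z → trans (level-zero-row k (h i) (h≡0 i) z) (sym (level-zero-row k (h j) (h≡0 j) z)))

  level-suc-bound : ∀ k t {r} → IsRank p (W* p (suc t) n) r → ClassBound p (W p k n) (level k) (suc t) r
  level-suc-bound k t (_ , maximal) {q} h h≡t+1 h-indep = maximal q directions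
    (independent-of-restriction p (W p k n) {M′ = W* p (suc t) n} {g = h} {f = directions}
      (reduce (suc t)) (λ i → proj₂ (factors i)) h-indep)
    where
    factors : ∀ i → Σ (Direction p (suc t) n) (RowFactors k (suc t) (h i))
    factors i = level-row-factors k (h i) (h≡t+1 i)
    directions : Fin q → Direction p (suc t) n
    directions i = proj₁ (factors i)

  rank-W≤ : ∀ k {r₀} {r : ℕ → ℕ} → IsRank p (W p k n) r₀ →
    (∀ j → 1 ≤ j → j ≤ k → IsRank p (W* p j n) (r j)) → r₀ ≤ 1 + sum1to k r
  rank-W≤ k {r = r} ((g , g-indep) , _) ranks =
    independent-≤-∑ClassBound p (W p k n) (level k) B k bound g-indep (λ i → level≤ k (g i))
    where
    B : ℕ → ℕ
    B zero    = 1
    B (suc t) = r (suc t)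
    bound : ∀ t → t ≤ k → ClassBound p (W p k n) (level k) t (B t)
    bound zero    _     = level-zero-bound k
    bound (suc t) t+1≤k = level-suc-bound k t (ranks (suc t) (s≤s z≤n) t+1≤k)

  lift : ∀ {j k} → j ≤ k → Direction p j n → Direction p k n
  lift {j} {k} j≤k (b , i , b-pivot , b-before) =
    b′ , i , trans (b′≡b i) b-pivot , λ i′ i′<i → subst (p ∣_) (sym (b′≡b i′)) (b-before i′ i′<i)
    where
    b′ : Vecs p k n
    b′ i′ = inject≤ (b i′) (^-monoʳ-≤ p j≤k)
    b′≡b : ∀ i′ → toℕ (b′ i′) ≡ toℕ (b i′)
    b′≡b i′ = toℕ-inject≤ (b i′) (^-monoʳ-≤ p j≤k)

  embed : ∀ {j k} → j ≤ k → Vecs p j n → Vecs p k n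
  embed {j} {k} j≤k w i = fromℕ< (subst (p ^ (k ∸ j) * toℕ (w i) <_) (p^[k∸m]*p^m≡p^k j≤k)
    (*-monoʳ-< (p ^ (k ∸ j)) {{m^n≢0 p (k ∸ j)}} (toℕ<n (w i))))

  W*-lift-embed : ∀ {j k} (j≤k : j ≤ k) d w → W* p k n (lift j≤k d) (embed j≤k w) ≡ W* p j n d w
  W*-lift-embed {j} {k} j≤k d w = indicator-cong (_ ∣? _) (_ ∣? _)
    (subst₂ (λ a b → (a ∣ b) ⇔ (p ^ j ∣ dotℕ p j n w (proj₁ d)))
      (p^[k∸m]*p^m≡p^k j≤k) (sym dot-embed) (*-cancelˡ-∣⇔ (p ^ (k ∸ j)) {{m^n≢0 p (k ∸ j)}}))
    where
    dot-embed : dotℕ p k n (embed j≤k w) (proj₁ (lift j≤k d)) ≡ p ^ (k ∸ j) * dotℕ p j n w (proj₁ d)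
    dot-embed = trans (sumFin-scaled n (p ^ (k ∸ j)) _ (λ i → toℕ-fromℕ< _))
      (cong (p ^ (k ∸ j) *_) (sumFin-cong n (λ i → cong (toℕ (w i) *_) (toℕ-inject≤ _ _))))

  rank-W*-mono : ∀ {j k rⱼ rₖ} → j ≤ k → IsRank p (W* p j n) rⱼ → IsRank p (W* p k n) rₖ → rⱼ ≤ rₖ
  rank-W*-mono {j} {k} j≤k ((g , g-indep) , _) (_ , maximal) = maximal _ (lift j≤k ∘ g)
    (independent-of-restriction p (W* p j n) {M′ = W* p k n} {g = g} {f = lift j≤k ∘ g}
      (embed j≤k) (λ i w → sym (W*-lift-embed j≤k (g i) w)) g-indep)

proposition2p2 : (p n k : ℕ) → Prime p → 2 ≤ n → 1 ≤ k →
    (r₀ : ℕ) → (r : ℕ → ℕ) →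
    IsRank p (W p k n) r₀ →
    (∀ (j : ℕ) → 1 ≤ j → j ≤ k → IsRank p (W* p j n) (r j)) →
    (r₀ ≤ 1 + sum1to k r) × (r₀ ≤ 1 + k * r k)
proposition2p2 p n k p-prime _ 1≤k r₀ r rank-W ranks-W* =
  r₀≤1+∑ , ≤-trans r₀≤1+∑ (+-monoʳ-≤ 1 ∑≤k*rₖ)
  where
  r₀≤1+∑ : r₀ ≤ 1 + sum1to k r
  r₀≤1+∑ = rank-W≤ p-prime k rank-W ranks-W*
  ∑≤k*rₖ : sum1to k r ≤ k * r k
  ∑≤k*rₖ = sumFin-≤ k _ λ i → rank-W*-mono p-prime (toℕ<n i)
    (ranks-W* (suc (toℕ i)) (s≤s z≤n) (toℕ<n i)) (ranks-W* k 1≤k ≤-refl)
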